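{- Let $m\in\mathbb{N}$ be odd, $n\in\mathbb{N}_0$ and $\lambda\in\mathbb{C}$. Then $$m^{n}G_{n}(\lambda^{m})-mG_{n}(\lambda)=\sum_{k=0}^{n}\binom{n}{k}m^{k}G_{k}(\lambda^{m})\,Z_{n-k}(m-1;\lambda).$$
   Context: Apostol-Genocchi numbers: $\frac{2z}{\lambda e^{z}+1}=\sum_{n\ge0}G_{n}(\lambda)\frac{z^{n}}{n!}$. For $m,k\in\mathbb{N}_0$, $Z_{k}(m;\lambda)=\sum_{j=1}^{m}(-1)^{j+1}\lambda^{j}j^{k}$ (with $0^0=1$ irrelevant since $j\ge1$; $j^0=1$). -}

module Defs where

open import Level using (Level; _⊔_)
open import Algebra.Bundles using (CommutativeRing)
open import Data.Nat using (ℕ; zero; suc)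
import Data.Nat as N
open import Data.Nat.Combinatorics using (_C_)
open import Data.Product using (∃)
open import Relation.Binary.PropositionalEquality using (_≡_)
open import Relation.Nullary using (¬_)

OddN : ℕ → Set
OddN m = ∃ λ k → m ≡ suc (2 N.* k)

module _ {c ℓ : Level} (R : CommutativeRing c ℓ) where
  open CommutativeRing R

  cast : ℕ → Carrier
  cast zero = 0#
  cast (suc n) = 1# + cast n

  pow : Carrier → ℕ → Carrier
  pow x zero = 1#
  pow x (suc n) = x * pow x n

  sumTo : ℕ → (ℕ → Carrier) → Carrier
  sumTo zero f = f 0
  sumTo (suc n) f = sumTo n f + f (suc n)

  record IsCharZeroField : Set (c ⊔ ℓ) where
    field
      nontrivial : ¬ (1# ≈ 0#)
      inverse    : ∀ x → ¬ (x ≈ 0#) → ∃ λ y → x * y ≈ 1#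
      charZero   : ∀ n → ¬ (cast (suc n) ≈ 0#)

  -- coefficient of z^n/n! in 2z
  twoZCoeff : ℕ → Carrier
  twoZCoeff 1 = 1# + 1#
  twoZCoeff _ = 0#

  -- G is the sequence of Apostol-Genocchi numbers G_n(λ), i.e.
  --   (λ e^z + 1) · Σ_n G n z^n/n! = 2z  as formal power series,
  -- written out coefficientwise (coefficient of z^n/n!):
  --   λ Σ_{k=0}^{n} C(n,k) G k + G n = [z^n/n!] 2z
  IsApostolGenocchi : Carrier → (ℕ → Carrier) → Set ℓ
  IsApostolGenocchi lam G =
    ∀ n → lam * sumTo n (λ k → cast (n C k) * G k) + G n ≈ twoZCoeff n

  -- Z_k(m; λ) = Σ_{j=1}^{m} (-1)^{j+1} λ^j j^k
  Z : ℕ → ℕ → Carrier → Carrier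
  Z k zero lam = 0#
  Z k (suc j) lam =
    Z k j lam + pow (- 1#) (suc (suc j)) * pow lam (suc j) * cast (suc j N.^ k)

-- We work with exponential generating functions: a sequence f : ℕ → R stands
-- for Σ f n zⁿ/n!, the product of series is the binomial convolution f ⋆ g,
-- e^{az} is the sequence exp a = (aⁿ), and multiplication by (a e^z + 1) is
-- the operator  L a f = a (f ⋆ exp 1) + f.  The hypothesis on G says
-- L λ G = 2z, and the hypothesis on Gm says Gm(z)(λᵐ e^z + 1) = 2z.
--
-- For m = 2k+1 put  W = Σ_{i=0}^{2k} (-λ)ⁱ e^{iz}.  This geometric sum
-- telescopes:  (λ e^z + 1) W = 1 + λᵐ e^{mz},  so  X = Gm(mz) · W  satisfies
-- L λ X = Gm(mz)(λᵐ e^{mz} + 1) = 2mz = m · 2z.  Over a field of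
-- characteristic zero, L λ has at most one solution of L λ f = c·2z
-- (because G(z)(λ e^z + 1) = 2z and 2z is not a zero divisor), hence X = m G.
-- Finally the coefficients of W are δ - Z(·; 2k; λ), and expanding X = m G
-- coefficientwise is exactly the claimed identity.

module Submission where

open import Defs
open import Level using (Level)
open import Algebra.Bundles using (CommutativeRing)
open import Data.Nat using (ℕ; zero; suc; _∸_; _≤_; _<_; z≤n; s≤s)
import Data.Nat as N
import Data.Nat.Properties as NP
open import Data.Nat.Combinatorics using (_C_; nCk+nC[k+1]≡[n+1]C[k+1]; k>n⇒nCk≡0)
open import Data.Sum using (inj₁; inj₂)
open import Data.Product using (∃; _,_)
open import Data.Maybe using (nothing)
import Relation.Binary.PropositionalEquality as P

module Development {c ℓ : Level} (R : CommutativeRing c ℓ) where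
  open CommutativeRing R
  open import Relation.Binary.Reasoning.Setoid setoid
  open import Algebra.Properties.Ring ring
    using (-1*x≈-x; -‿involutive; -‿distribˡ-*; -‿distribʳ-*)
  open import Algebra.Properties.AbelianGroup +-abelianGroup using (⁻¹-∙-comm; ε⁻¹≈ε)
  open import Algebra.Solver.Ring.NaturalCoefficients commutativeSemiring (λ _ _ → nothing)

  -- Coefficient sequences of exponential generating functions.
  Seq : Set c
  Seq = ℕ → Carrier

  Σ : ℕ → Seq → Carrier
  Σ = sumTo R

  ⌜_⌝ : ℕ → Carrier
  ⌜_⌝ = cast R

  _^_ : Carrier → ℕ → Carrier
  _^_ = pow R

  neg-+ : ∀ a b → - (a + b) ≈ - a + - b
  neg-+ a b = sym (⁻¹-∙-comm a b)

  neg-*-neg : ∀ a b → - a * - b ≈ a * b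
  neg-*-neg a b = trans (sym (-‿distribˡ-* a (- b))) (trans (-‿cong (sym (-‿distribʳ-* a b))) (-‿involutive _))

  swap-sub : ∀ x y z → x ≈ y - z → y - x ≈ z
  swap-sub x y z p = begin
    y - x            ≈⟨ +-congˡ (-‿cong p) ⟩
    y - (y - z)      ≈⟨ +-congˡ (trans (neg-+ y (- z)) (+-congˡ (-‿involutive z))) ⟩
    y + (- y + z)    ≈⟨ sym (+-assoc _ _ _) ⟩
    (y - y) + z      ≈⟨ +-congʳ (-‿inverseʳ y) ⟩
    0# + z           ≈⟨ +-identityˡ z ⟩
    z                ∎

  unit-cancel : ∀ u x → (∃ λ v → u * v ≈ 1#) → u * x ≈ 0# → x ≈ 0#
  unit-cancel u x (v , uv≈1) ux≈0 = begin
    x               ≈⟨ sym (*-identityˡ x) ⟩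
    1# * x          ≈⟨ *-congʳ (sym uv≈1) ⟩
    (u * v) * x     ≈⟨ solve 3 (λ u v x → (u :* v) :* x := v :* (u :* x)) refl u v x ⟩
    v * (u * x)     ≈⟨ *-congˡ ux≈0 ⟩
    v * 0#          ≈⟨ zeroʳ v ⟩
    0#              ∎

  Σ-cong≤ : ∀ n {f g : Seq} → (∀ k → k ≤ n → f k ≈ g k) → Σ n f ≈ Σ n g
  Σ-cong≤ zero p = p 0 z≤n
  Σ-cong≤ (suc n) p = +-cong (Σ-cong≤ n (λ k k≤n → p k (NP.m≤n⇒m≤1+n k≤n))) (p (suc n) NP.≤-refl)

  Σ-cong : ∀ n {f g : Seq} → (∀ k → f k ≈ g k) → Σ n f ≈ Σ n g
  Σ-cong n p = Σ-cong≤ n (λ k _ → p k)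

  Σ-+ : ∀ n (f g : Seq) → Σ n (λ k → f k + g k) ≈ Σ n f + Σ n g
  Σ-+ zero f g = refl
  Σ-+ (suc n) f g = begin
    Σ n (λ k → f k + g k) + (f (suc n) + g (suc n))  ≈⟨ +-congʳ (Σ-+ n f g) ⟩
    (Σ n f + Σ n g) + (f (suc n) + g (suc n))
      ≈⟨ solve 4 (λ a b x y → (a :+ b) :+ (x :+ y) := (a :+ x) :+ (b :+ y)) refl
           (Σ n f) (Σ n g) (f (suc n)) (g (suc n)) ⟩
    (Σ n f + f (suc n)) + (Σ n g + g (suc n))        ∎

  Σ-*ˡ : ∀ n a (f : Seq) → a * Σ n f ≈ Σ n (λ k → a * f k)
  Σ-*ˡ zero a f = refl
  Σ-*ˡ (suc n) a f = trans (distribˡ a (Σ n f) (f (suc n))) (+-congʳ (Σ-*ˡ n a f))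

  Σ-neg : ∀ n (f : Seq) → Σ n (λ k → - f k) ≈ - Σ n f
  Σ-neg zero f = refl
  Σ-neg (suc n) f = trans (+-congʳ (Σ-neg n f)) (sym (neg-+ _ _))

  Σ-zero : ∀ n (f : Seq) → (∀ k → f k ≈ 0#) → Σ n f ≈ 0#
  Σ-zero zero f p = p 0
  Σ-zero (suc n) f p = trans (+-cong (Σ-zero n f p) (p (suc n))) (+-identityˡ 0#)

  Σ-head : ∀ n (f : Seq) → Σ (suc n) f ≈ f 0 + Σ n (λ k → f (suc k))
  Σ-head zero f = refl
  Σ-head (suc n) f = trans (+-congʳ (Σ-head n f)) (+-assoc _ _ _)

  Σ-head-vanishing : ∀ n (f : Seq) → f (suc n) ≈ 0# → Σ n f ≈ f 0 + Σ n (λ k → f (suc k))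
  Σ-head-vanishing n f p = begin
    Σ n f                        ≈⟨ sym (+-identityʳ _) ⟩
    Σ n f + 0#                   ≈⟨ +-congˡ (sym p) ⟩
    Σ (suc n) f                  ≈⟨ Σ-head n f ⟩
    f 0 + Σ n (λ k → f (suc k))  ∎

  cast-+ : ∀ a b → ⌜ a N.+ b ⌝ ≈ ⌜ a ⌝ + ⌜ b ⌝
  cast-+ zero b = sym (+-identityˡ _)
  cast-+ (suc a) b = trans (+-congˡ (cast-+ a b)) (sym (+-assoc _ _ _))

  cast-* : ∀ a b → ⌜ a N.* b ⌝ ≈ ⌜ a ⌝ * ⌜ b ⌝
  cast-* zero b = sym (zeroˡ _)
  cast-* (suc a) b = begin
    ⌜ b N.+ a N.* b ⌝        ≈⟨ cast-+ b (a N.* b) ⟩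
    ⌜ b ⌝ + ⌜ a N.* b ⌝      ≈⟨ +-congˡ (cast-* a b) ⟩
    ⌜ b ⌝ + ⌜ a ⌝ * ⌜ b ⌝    ≈⟨ solve 2 (λ x y → y :+ x :* y := (con 1 :+ x) :* y) refl ⌜ a ⌝ ⌜ b ⌝ ⟩
    (1# + ⌜ a ⌝) * ⌜ b ⌝     ∎

  pow-cong : ∀ {x y} k → x ≈ y → x ^ k ≈ y ^ k
  pow-cong zero p = refl
  pow-cong (suc k) p = *-cong p (pow-cong k p)

  pow-1 : ∀ k → 1# ^ k ≈ 1#
  pow-1 zero = refl
  pow-1 (suc k) = trans (*-identityˡ _) (pow-1 k)

  cast-^ : ∀ a k → ⌜ a N.^ k ⌝ ≈ ⌜ a ⌝ ^ k
  cast-^ a zero = +-identityʳ 1#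
  cast-^ a (suc k) = trans (cast-* a (a N.^ k)) (*-congˡ (cast-^ a k))

  pow-+ : ∀ x a b → x ^ (a N.+ b) ≈ x ^ a * x ^ b
  pow-+ x zero b = sym (*-identityˡ _)
  pow-+ x (suc a) b = trans (*-congˡ (pow-+ x a b)) (sym (*-assoc _ _ _))

  pow-* : ∀ x y k → (x * y) ^ k ≈ x ^ k * y ^ k
  pow-* x y zero = sym (*-identityˡ 1#)
  pow-* x y (suc k) = trans (*-congˡ (pow-* x y k))
    (solve 4 (λ a b c d → (a :* b) :* (c :* d) := (a :* c) :* (b :* d)) refl x y (x ^ k) (y ^ k))

  pow-neg-even : ∀ x k → (- x) ^ (2 N.* k) ≈ x ^ (2 N.* k)
  pow-neg-even x k = P.subst (λ e → (- x) ^ (k N.+ e) ≈ x ^ (k N.+ e)) (P.sym (NP.+-identityʳ k)) (begin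
    (- x) ^ (k N.+ k)           ≈⟨ pow-+ (- x) k k ⟩
    (- x) ^ k * (- x) ^ k       ≈⟨ sym (pow-* (- x) (- x) k) ⟩
    (- x * - x) ^ k             ≈⟨ pow-cong k (neg-*-neg x x) ⟩
    (x * x) ^ k                 ≈⟨ pow-* x x k ⟩
    x ^ k * x ^ k               ≈⟨ sym (pow-+ x k k) ⟩
    x ^ (k N.+ k)               ∎)

  -- Binomial convolution: the product of exponential generating functions.
  _⋆_ : Seq → Seq → Seq
  (f ⋆ g) n = Σ n (λ k → ⌜ n C k ⌝ * f k * g (n ∸ k))

  -- Shift (the derivative d/dz of an exponential generating function).
  Δ : Seq → Seq
  Δ f n = f (suc n)

  -- e^{az}, and its special case the unit 1 = e^{0z}.
  exp : Carrier → Seq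
  exp a n = a ^ n

  δ : Seq
  δ = exp 0#

  ⋆-congˡ : ∀ {f f' : Seq} (g : Seq) → (∀ k → f k ≈ f' k) → ∀ n → (f ⋆ g) n ≈ (f' ⋆ g) n
  ⋆-congˡ g pf n = Σ-cong n (λ k → *-congʳ (*-congˡ (pf k)))

  ⋆-congʳ : ∀ (f : Seq) {g g' : Seq} → (∀ k → g k ≈ g' k) → ∀ n → (f ⋆ g) n ≈ (f ⋆ g') n
  ⋆-congʳ f pg n = Σ-cong n (λ k → *-congˡ (pg (n ∸ k)))

  ⋆-+ˡ : ∀ (f f' g : Seq) n → ((λ k → f k + f' k) ⋆ g) n ≈ (f ⋆ g) n + (f' ⋆ g) n
  ⋆-+ˡ f f' g n = trans (Σ-cong n (λ k → solve 4 (λ c a b x → c :* (a :+ b) :* x := c :* a :* x :+ c :* b :* x)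
    refl ⌜ n C k ⌝ (f k) (f' k) (g (n ∸ k)))) (Σ-+ n _ _)

  ⋆-+ʳ : ∀ (f g g' : Seq) n → (f ⋆ (λ k → g k + g' k)) n ≈ (f ⋆ g) n + (f ⋆ g') n
  ⋆-+ʳ f g g' n = trans (Σ-cong n (λ k → distribˡ _ _ _)) (Σ-+ n _ _)

  ⋆-*ˡ : ∀ a (f g : Seq) n → ((λ k → a * f k) ⋆ g) n ≈ a * (f ⋆ g) n
  ⋆-*ˡ a f g n = sym (trans (Σ-*ˡ n a _) (Σ-cong n (λ k → solve 4 (λ a c x y → a :* (c :* x :* y) := c :* (a :* x) :* y)
    refl a ⌜ n C k ⌝ (f k) (g (n ∸ k)))))

  ⋆-*ʳ : ∀ a (f g : Seq) n → (f ⋆ (λ k → a * g k)) n ≈ a * (f ⋆ g) n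
  ⋆-*ʳ a f g n = sym (trans (Σ-*ˡ n a _) (Σ-cong n (λ k → solve 4 (λ a c x y → a :* (c :* x :* y) := c :* x :* (a :* y))
    refl a ⌜ n C k ⌝ (f k) (g (n ∸ k)))))

  ⋆-negʳ : ∀ (f g : Seq) n → (f ⋆ (λ k → - g k)) n ≈ - (f ⋆ g) n
  ⋆-negʳ f g n = trans (Σ-cong n (λ k → sym (-‿distribʳ-* _ _))) (Σ-neg n _)

  -- Leibniz rule  (fg)' = f'g + fg',  from Pascal's rule; it drives all the
  -- inductive proofs about ⋆ below.
  leibniz : ∀ (f g : Seq) n → (f ⋆ g) (suc n) ≈ (Δ f ⋆ g) n + (f ⋆ Δ g) n
  leibniz f g n = begin
    (f ⋆ g) (suc n)                        ≈⟨ Σ-head n _ ⟩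
    F0 + Σ n (λ k → ⌜ suc n C suc k ⌝ * f (suc k) * g (n ∸ k))
                                           ≈⟨ +-congˡ (Σ-cong n pascal) ⟩
    F0 + Σ n (λ k → A k + B k)             ≈⟨ +-congˡ (Σ-+ n A B) ⟩
    F0 + (Σ n A + Σ n B)                   ≈⟨ solve 3 (λ x a b → x :+ (a :+ b) := a :+ (x :+ b)) refl F0 (Σ n A) (Σ n B) ⟩
    (Δ f ⋆ g) n + (F0 + Σ n B)             ≈⟨ +-congˡ (sym (trans (Σ-head-vanishing n h (term-vanishes (suc n) NP.≤-refl))
                                                                  (+-congˡ (Σ-cong≤ n reindex)))) ⟩
    (Δ f ⋆ g) n + (f ⋆ Δ g) n              ∎
    where
    F0 = ⌜ suc n C 0 ⌝ * f 0 * g (suc n)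
    A B h : Seq
    A k = ⌜ n C k ⌝ * f (suc k) * g (n ∸ k)
    B k = ⌜ n C suc k ⌝ * f (suc k) * g (n ∸ k)
    h k = ⌜ n C k ⌝ * f k * g (suc (n ∸ k))
    pascal : ∀ k → ⌜ suc n C suc k ⌝ * f (suc k) * g (n ∸ k) ≈ A k + B k
    pascal k = begin
      ⌜ suc n C suc k ⌝ * f (suc k) * g (n ∸ k)
        ≈⟨ P.subst (λ e → ⌜ suc n C suc k ⌝ * f (suc k) * g (n ∸ k) ≈ ⌜ e ⌝ * f (suc k) * g (n ∸ k))
             (P.sym (nCk+nC[k+1]≡[n+1]C[k+1] n k)) refl ⟩
      ⌜ n C k N.+ n C suc k ⌝ * f (suc k) * g (n ∸ k)
        ≈⟨ *-congʳ (*-congʳ (cast-+ (n C k) (n C suc k))) ⟩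
      (⌜ n C k ⌝ + ⌜ n C suc k ⌝) * f (suc k) * g (n ∸ k)
        ≈⟨ solve 4 (λ a b x y → (a :+ b) :* x :* y := a :* x :* y :+ b :* x :* y) refl
             ⌜ n C k ⌝ ⌜ n C suc k ⌝ (f (suc k)) (g (n ∸ k)) ⟩
      A k + B k ∎
    term-vanishes : ∀ k → n < k → h k ≈ 0#
    term-vanishes k n<k = begin
      ⌜ n C k ⌝ * f k * g (suc (n ∸ k))  ≈⟨ P.subst (λ e → ⌜ n C k ⌝ * f k * g (suc (n ∸ k)) ≈ ⌜ e ⌝ * f k * g (suc (n ∸ k)))
                                              (k>n⇒nCk≡0 n<k) refl ⟩
      0# * f k * g (suc (n ∸ k))         ≈⟨ *-congʳ (zeroˡ _) ⟩
      0# * g (suc (n ∸ k))               ≈⟨ zeroˡ _ ⟩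
      0#                                 ∎
    suc-∸ : ∀ n k → k < n → suc (n ∸ suc k) P.≡ n ∸ k
    suc-∸ (suc n) zero _ = P.refl
    suc-∸ (suc n) (suc k) (s≤s k<n) = suc-∸ n k k<n
    reindex : ∀ k → k ≤ n → h (suc k) ≈ B k
    reindex k k≤n with NP.m≤n⇒m<n∨m≡n k≤n
    ... | inj₁ k<n = P.subst (λ e → h (suc k) ≈ ⌜ n C suc k ⌝ * f (suc k) * g e) (suc-∸ n k k<n) refl
    ... | inj₂ P.refl = trans (term-vanishes (suc n) NP.≤-refl)
                              (sym (trans (*-congʳ (*-congʳ (P.subst (λ e → ⌜ e ⌝ ≈ 0#)
                                (P.sym (k>n⇒nCk≡0 (NP.n<1+n n))) refl))) (trans (*-congʳ (zeroˡ _)) (zeroˡ _))))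

  ⋆-comm : ∀ n (f g : Seq) → (f ⋆ g) n ≈ (g ⋆ f) n
  ⋆-comm zero f g = solve 3 (λ c x y → c :* x :* y := c :* y :* x) refl ⌜ 1 ⌝ (f 0) (g 0)
  ⋆-comm (suc n) f g = begin
    (f ⋆ g) (suc n)                  ≈⟨ leibniz f g n ⟩
    (Δ f ⋆ g) n + (f ⋆ Δ g) n        ≈⟨ +-cong (⋆-comm n (Δ f) g) (⋆-comm n f (Δ g)) ⟩
    (g ⋆ Δ f) n + (Δ g ⋆ f) n        ≈⟨ +-comm _ _ ⟩
    (Δ g ⋆ f) n + (g ⋆ Δ f) n        ≈⟨ sym (leibniz g f n) ⟩
    (g ⋆ f) (suc n)                  ∎

  ⋆-assoc : ∀ n (f g h : Seq) → ((f ⋆ g) ⋆ h) n ≈ (f ⋆ (g ⋆ h)) n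
  ⋆-assoc zero f g h = solve 4 (λ c x y z → c :* (c :* x :* y) :* z := c :* x :* (c :* y :* z))
    refl ⌜ 1 ⌝ (f 0) (g 0) (h 0)
  ⋆-assoc (suc n) f g h = begin
    ((f ⋆ g) ⋆ h) (suc n)                                          ≈⟨ leibniz (f ⋆ g) h n ⟩
    (Δ (f ⋆ g) ⋆ h) n + ((f ⋆ g) ⋆ Δ h) n                          ≈⟨ +-congʳ (⋆-congˡ h (leibniz f g) n) ⟩
    ((λ k → (Δ f ⋆ g) k + (f ⋆ Δ g) k) ⋆ h) n + ((f ⋆ g) ⋆ Δ h) n  ≈⟨ +-congʳ (⋆-+ˡ _ _ h n) ⟩
    (((Δ f ⋆ g) ⋆ h) n + ((f ⋆ Δ g) ⋆ h) n) + ((f ⋆ g) ⋆ Δ h) n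
      ≈⟨ +-cong (+-cong (⋆-assoc n (Δ f) g h) (⋆-assoc n f (Δ g) h)) (⋆-assoc n f g (Δ h)) ⟩
    ((Δ f ⋆ (g ⋆ h)) n + (f ⋆ (Δ g ⋆ h)) n) + (f ⋆ (g ⋆ Δ h)) n    ≈⟨ +-assoc _ _ _ ⟩
    (Δ f ⋆ (g ⋆ h)) n + ((f ⋆ (Δ g ⋆ h)) n + (f ⋆ (g ⋆ Δ h)) n)    ≈⟨ +-congˡ (sym (⋆-+ʳ f (Δ g ⋆ h) (g ⋆ Δ h) n)) ⟩
    (Δ f ⋆ (g ⋆ h)) n + (f ⋆ (λ k → (Δ g ⋆ h) k + (g ⋆ Δ h) k)) n  ≈⟨ +-congˡ (⋆-congʳ f (λ k → sym (leibniz g h k)) n) ⟩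
    (Δ f ⋆ (g ⋆ h)) n + (f ⋆ Δ (g ⋆ h)) n                          ≈⟨ sym (leibniz f (g ⋆ h) n) ⟩
    (f ⋆ (g ⋆ h)) (suc n)                                          ∎

  ⋆-δ : ∀ n (f : Seq) → (f ⋆ δ) n ≈ f n
  ⋆-δ zero f = trans (*-identityʳ _) (trans (*-congʳ (+-identityʳ 1#)) (*-identityˡ _))
  ⋆-δ (suc n) f = begin
    (f ⋆ δ) (suc n)              ≈⟨ leibniz f δ n ⟩
    (Δ f ⋆ δ) n + (f ⋆ Δ δ) n    ≈⟨ +-cong (⋆-δ n (Δ f)) (trans (⋆-congʳ f {g' = λ _ → 0#} (λ k → zeroˡ (exp 0# k)) n)
                                                                (Σ-zero n _ (λ k → zeroʳ _))) ⟩
    f (suc n) + 0#               ≈⟨ +-identityʳ _ ⟩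
    f (suc n)                    ∎

  ⋆-exp : ∀ a b n → (exp a ⋆ exp b) n ≈ exp (a + b) n
  ⋆-exp a b zero = trans (*-identityʳ _) (trans (*-identityʳ _) (+-identityʳ 1#))
  ⋆-exp a b (suc n) = begin
    (exp a ⋆ exp b) (suc n)                              ≈⟨ leibniz (exp a) (exp b) n ⟩
    ((λ k → a * exp a k) ⋆ exp b) n + (exp a ⋆ (λ k → b * exp b k)) n
                                                         ≈⟨ +-cong (⋆-*ˡ a (exp a) (exp b) n) (⋆-*ʳ b (exp a) (exp b) n) ⟩
    a * (exp a ⋆ exp b) n + b * (exp a ⋆ exp b) n        ≈⟨ sym (distribʳ _ _ _) ⟩
    (a + b) * (exp a ⋆ exp b) n                          ≈⟨ *-congˡ (⋆-exp a b n) ⟩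
    exp (a + b) (suc n)                                  ∎

  -- The series 2z; convolving with it is "multiply by 2, integrate".
  T : Seq
  T = twoZCoeff R

  ⋆-T : ∀ n (f : Seq) → (T ⋆ f) (suc n) ≈ (1# + 1#) * ⌜ suc n ⌝ * f n
  ⋆-T zero f = trans (+-congʳ (trans (*-congʳ (zeroʳ _)) (zeroˡ _)))
    (trans (+-identityˡ _) (solve 3 (λ c t x → c :* t :* x := t :* c :* x) refl ⌜ 1 ⌝ (1# + 1#) (f 0)))
  ⋆-T (suc n) f = begin
    (T ⋆ f) (suc (suc n))                                ≈⟨ leibniz T f (suc n) ⟩
    (Δ T ⋆ f) (suc n) + (T ⋆ Δ f) (suc n)                ≈⟨ +-cong ΔT⋆f (⋆-T n (Δ f)) ⟩
    (1# + 1#) * f (suc n) + (1# + 1#) * ⌜ suc n ⌝ * f (suc n)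
      ≈⟨ solve 3 (λ t c x → t :* x :+ t :* c :* x := t :* (con 1 :+ c) :* x) refl (1# + 1#) ⌜ suc n ⌝ (f (suc n)) ⟩
    (1# + 1#) * ⌜ suc (suc n) ⌝ * f (suc n)              ∎
    where
    ΔT≈2δ : ∀ k → Δ T k ≈ (1# + 1#) * δ k
    ΔT≈2δ zero = sym (*-identityʳ _)
    ΔT≈2δ (suc k) = sym (trans (*-congˡ (zeroˡ _)) (zeroʳ _))
    ΔT⋆f : (Δ T ⋆ f) (suc n) ≈ (1# + 1#) * f (suc n)
    ΔT⋆f = trans (⋆-congˡ f ΔT≈2δ (suc n))
             (trans (⋆-*ˡ (1# + 1#) δ f (suc n)) (*-congˡ (trans (⋆-comm (suc n) δ f) (⋆-δ (suc n) f))))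

  -- Multiplication by (a e^z + 1).
  L : Carrier → Seq → Seq
  L a f n = a * (f ⋆ exp 1#) n + f n

  L-cong : ∀ a {f g : Seq} → (∀ k → f k ≈ g k) → ∀ n → L a f n ≈ L a g n
  L-cong a p n = +-cong (*-congˡ (⋆-congˡ (exp 1#) p n)) (p n)

  L-⋆ : ∀ a (f g : Seq) n → (f ⋆ L a g) n ≈ L a (f ⋆ g) n
  L-⋆ a f g n = begin
    (f ⋆ L a g) n                                       ≈⟨ ⋆-+ʳ f (λ k → a * (g ⋆ exp 1#) k) g n ⟩
    (f ⋆ (λ k → a * (g ⋆ exp 1#) k)) n + (f ⋆ g) n      ≈⟨ +-congʳ (⋆-*ʳ a f (g ⋆ exp 1#) n) ⟩
    a * (f ⋆ (g ⋆ exp 1#)) n + (f ⋆ g) n                ≈⟨ +-congʳ (*-congˡ (sym (⋆-assoc n f g (exp 1#)))) ⟩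
    L a (f ⋆ g) n                                       ∎

  L-+ : ∀ a (f g : Seq) n → L a (λ k → f k + g k) n ≈ L a f n + L a g n
  L-+ a f g n = begin
    a * ((λ k → f k + g k) ⋆ exp 1#) n + (f n + g n)
      ≈⟨ +-congʳ (*-congˡ (⋆-+ˡ f g (exp 1#) n)) ⟩
    a * ((f ⋆ exp 1#) n + (g ⋆ exp 1#) n) + (f n + g n)
      ≈⟨ solve 5 (λ a x y u v → a :* (x :+ y) :+ (u :+ v) := (a :* x :+ u) :+ (a :* y :+ v))
           refl a ((f ⋆ exp 1#) n) ((g ⋆ exp 1#) n) (f n) (g n) ⟩
    L a f n + L a g n ∎

  L-* : ∀ a b (f : Seq) n → L a (λ k → b * f k) n ≈ b * L a f n
  L-* a b f n = begin
    a * ((λ k → b * f k) ⋆ exp 1#) n + b * f n    ≈⟨ +-congʳ (*-congˡ (⋆-*ˡ b f (exp 1#) n)) ⟩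
    a * (b * (f ⋆ exp 1#) n) + b * f n
      ≈⟨ solve 4 (λ a b c x → a :* (b :* c) :+ b :* x := b :* (a :* c :+ x)) refl a b ((f ⋆ exp 1#) n) (f n) ⟩
    b * L a f n                                   ∎

  L-exp : ∀ a b n → L a (exp b) n ≈ a * exp (1# + b) n + exp b n
  L-exp a b n = +-congʳ (*-congˡ (trans (⋆-exp b 1# n) (pow-cong n (+-comm b 1#))))

  apostol-genocchi-L : ∀ a (G : Seq) → IsApostolGenocchi R a G → ∀ n → L a G n ≈ T n
  apostol-genocchi-L a G hG n = trans (+-congʳ (*-congˡ (Σ-cong n (λ k → trans (*-congˡ (pow-1 (n ∸ k))) (*-identityʳ _))))) (hG n)

  -- If g(z)(μ e^z + 1) = 2z then the dilation g(Mz) satisfies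
  -- g(Mz)(μ e^{Mz} + 1) = 2Mz.
  dilate : Carrier → Seq → Seq
  dilate M g k = M ^ k * g k

  dilate-⋆-exp : ∀ M (g : Seq) n → (dilate M g ⋆ exp M) n ≈ M ^ n * Σ n (λ k → ⌜ n C k ⌝ * g k)
  dilate-⋆-exp M g n = trans (Σ-cong≤ n term) (sym (Σ-*ˡ n (M ^ n) _))
    where
    term : ∀ k → k ≤ n → ⌜ n C k ⌝ * dilate M g k * M ^ (n ∸ k) ≈ M ^ n * (⌜ n C k ⌝ * g k)
    term k k≤n = begin
      ⌜ n C k ⌝ * (M ^ k * g k) * M ^ (n ∸ k)
        ≈⟨ solve 4 (λ c a g b → c :* (a :* g) :* b := (a :* b) :* (c :* g)) refl ⌜ n C k ⌝ (M ^ k) (g k) (M ^ (n ∸ k)) ⟩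
      (M ^ k * M ^ (n ∸ k)) * (⌜ n C k ⌝ * g k)     ≈⟨ *-congʳ (sym (pow-+ M k (n ∸ k))) ⟩
      M ^ (k N.+ (n ∸ k)) * (⌜ n C k ⌝ * g k)       ≈⟨ P.subst (λ e → M ^ (k N.+ (n ∸ k)) * (⌜ n C k ⌝ * g k) ≈ M ^ e * (⌜ n C k ⌝ * g k))
                                                         (NP.m+[n∸m]≡n k≤n) refl ⟩
      M ^ n * (⌜ n C k ⌝ * g k)                     ∎

  dilate-equation : ∀ M μ (g : Seq) → IsApostolGenocchi R μ g →
    ∀ n → (dilate M g ⋆ (λ k → δ k + μ * exp M k)) n ≈ M * T n
  dilate-equation M μ g hg n = begin
    (dilate M g ⋆ (λ k → δ k + μ * exp M k)) n             ≈⟨ ⋆-+ʳ (dilate M g) δ (λ k → μ * exp M k) n ⟩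
    (dilate M g ⋆ δ) n + (dilate M g ⋆ (λ k → μ * exp M k)) n
                                                           ≈⟨ +-cong (⋆-δ n (dilate M g)) (⋆-*ʳ μ (dilate M g) (exp M) n) ⟩
    M ^ n * g n + μ * (dilate M g ⋆ exp M) n               ≈⟨ +-congˡ (*-congˡ (dilate-⋆-exp M g n)) ⟩
    M ^ n * g n + μ * (M ^ n * s)
      ≈⟨ solve 4 (λ p x u s → p :* x :+ u :* (p :* s) := p :* (u :* s :+ x)) refl (M ^ n) (g n) μ s ⟩
    M ^ n * (μ * s + g n)                                  ≈⟨ *-congˡ (hg n) ⟩
    M ^ n * T n                                            ≈⟨ supported-at-1 n ⟩
    M * T n                                                ∎
    where
    s = Σ n (λ k → ⌜ n C k ⌝ * g k)
    -- 2z only has a coefficient in degree 1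
    supported-at-1 : ∀ n → M ^ n * T n ≈ M * T n
    supported-at-1 zero = trans (zeroʳ _) (sym (zeroʳ _))
    supported-at-1 (suc zero) = *-congʳ (*-identityʳ M)
    supported-at-1 (suc (suc n)) = trans (zeroʳ _) (sym (zeroʳ _))

  -- Over a field of characteristic zero, L a f = c·2z has at most the
  -- solution c·G, where L a G = 2z: if L a D = 0 then
  -- 2z·D = G(a e^z + 1)D = 0, and 2z is not a zero divisor.
  module _ (F : IsCharZeroField R) where
    open IsCharZeroField F

    -- the coefficient 2(n+1) produced by convolving with 2z is a unit
    two-suc-invertible : ∀ n → ∃ λ v → (1# + 1#) * ⌜ suc n ⌝ * v ≈ 1#
    two-suc-invertible n with inverse ⌜ 2 N.* suc n ⌝ (charZero (n N.+ suc (n N.+ 0)))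
    ... | v , uv≈1 = v , trans (*-congʳ (sym (trans (cast-* 2 (suc n)) (*-congʳ (+-congˡ (+-identityʳ 1#)))))) uv≈1

    L-annihilator : ∀ a (G D : Seq) → (∀ n → L a G n ≈ T n) → (∀ n → L a D n ≈ 0#) → ∀ n → D n ≈ 0#
    L-annihilator a G D hG hD n = unit-cancel _ (D n) (two-suc-invertible n) (begin
      (1# + 1#) * ⌜ suc n ⌝ * D n    ≈⟨ sym (⋆-T n D) ⟩
      (T ⋆ D) (suc n)                ≈⟨ ⋆-congˡ D (λ k → sym (hG k)) (suc n) ⟩
      (L a G ⋆ D) (suc n)            ≈⟨ ⋆-comm (suc n) (L a G) D ⟩
      (D ⋆ L a G) (suc n)            ≈⟨ L-⋆ a D G (suc n) ⟩
      L a (D ⋆ G) (suc n)            ≈⟨ L-cong a (λ k → ⋆-comm k D G) (suc n) ⟩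
      L a (G ⋆ D) (suc n)            ≈⟨ sym (L-⋆ a G D (suc n)) ⟩
      (G ⋆ L a D) (suc n)            ≈⟨ ⋆-congʳ G hD (suc n) ⟩
      (G ⋆ (λ _ → 0#)) (suc n)       ≈⟨ Σ-zero (suc n) _ (λ k → zeroʳ _) ⟩
      0#                             ∎)

    L-unique : ∀ a b (G X : Seq) → (∀ n → L a G n ≈ T n) → (∀ n → L a X n ≈ b * T n) → ∀ n → X n ≈ b * G n
    L-unique a b G X hG hX n = begin
      X n                              ≈⟨ sym (+-identityʳ _) ⟩
      X n + 0#                         ≈⟨ +-congˡ (sym (trans (+-congʳ (sym (-‿distribˡ-* b (G n)))) (-‿inverseˡ _))) ⟩
      X n + (- b * G n + b * G n)      ≈⟨ sym (+-assoc _ _ _) ⟩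
      D n + b * G n                    ≈⟨ +-congʳ (L-annihilator a G D hG hD n) ⟩
      0# + b * G n                     ≈⟨ +-identityˡ _ ⟩
      b * G n                          ∎
      where
      D : Seq
      D k = X k + - b * G k
      hD : ∀ n → L a D n ≈ 0#
      hD n = begin
        L a D n                        ≈⟨ trans (L-+ a X _ n) (+-congˡ (L-* a (- b) G n)) ⟩
        L a X n + - b * L a G n        ≈⟨ +-cong (hX n) (*-congˡ (hG n)) ⟩
        b * T n + - b * T n            ≈⟨ +-congˡ (sym (-‿distribˡ-* b (T n))) ⟩
        b * T n - b * T n              ≈⟨ -‿inverseʳ _ ⟩
        0#                             ∎

  module Geometric (lam : Carrier) where
    W : ℕ → Seq
    W j n = Σ j (λ i → (- lam) ^ i * exp ⌜ i ⌝ n)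

    L-W : ∀ j n → L lam (W j) n ≈ δ n + lam * ((- lam) ^ j * exp ⌜ suc j ⌝ n)
    L-W zero n = begin
      L lam (W 0) n                         ≈⟨ L-cong lam (λ k → *-identityˡ _) n ⟩
      L lam δ n                             ≈⟨ L-exp lam 0# n ⟩
      lam * exp ⌜ 1 ⌝ n + δ n               ≈⟨ solve 3 (λ l p d → l :* p :+ d := d :+ l :* (con 1 :* p)) refl lam (exp ⌜ 1 ⌝ n) (δ n) ⟩
      δ n + lam * (1# * exp ⌜ 1 ⌝ n)        ∎
    L-W (suc j) n = begin
      L lam (W (suc j)) n                   ≈⟨ L-+ lam (W j) _ n ⟩
      L lam (W j) n + L lam (λ k → nl * e * exp ⌜ suc j ⌝ k) n
                                            ≈⟨ +-cong (L-W j n) (trans (L-* lam (nl * e) _ n) (*-congˡ (L-exp lam ⌜ suc j ⌝ n))) ⟩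
      (δ n + lam * (e * p)) + nl * e * (lam * q + p)
        ≈⟨ solve 7 (λ d l nl e p q x → (d :+ l :* (e :* p)) :+ nl :* e :* (l :* q :+ p)
                                       := d :+ (l :+ nl) :* (e :* p) :+ l :* (nl :* e :* q))
             refl (δ n) lam nl e p q (lam * (nl * e * q)) ⟩
      δ n + (lam + nl) * (e * p) + lam * (nl * e * q)
                                            ≈⟨ +-congʳ (+-congˡ (trans (*-congʳ (-‿inverseʳ lam)) (zeroˡ _))) ⟩
      δ n + 0# + lam * (nl * e * q)         ≈⟨ +-congʳ (+-identityʳ _) ⟩
      δ n + lam * (nl * e * q)              ∎
      where
      nl = - lam
      e = nl ^ j
      p = exp ⌜ suc j ⌝ n
      q = exp ⌜ suc (suc j) ⌝ n

    L-W-odd : ∀ k n → L lam (W (2 N.* k)) n ≈ δ n + lam ^ suc (2 N.* k) * exp ⌜ suc (2 N.* k) ⌝ n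
    L-W-odd k n = begin
      L lam (W (2 N.* k)) n                                           ≈⟨ L-W (2 N.* k) n ⟩
      δ n + lam * ((- lam) ^ (2 N.* k) * exp ⌜ suc (2 N.* k) ⌝ n)     ≈⟨ +-congˡ (*-congˡ (*-congʳ (pow-neg-even lam k))) ⟩
      δ n + lam * (lam ^ (2 N.* k) * exp ⌜ suc (2 N.* k) ⌝ n)         ≈⟨ +-congˡ (sym (*-assoc _ _ _)) ⟩
      δ n + lam ^ suc (2 N.* k) * exp ⌜ suc (2 N.* k) ⌝ n             ∎

    sign-of-Z-term : ∀ j → (- 1#) ^ suc (suc j) * lam ^ suc j ≈ - (- lam) ^ suc j
    sign-of-Z-term j = begin
      (- 1#) ^ suc (suc j) * lam ^ suc j      ≈⟨ *-congʳ (-1*x≈-x _) ⟩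
      - (- 1#) ^ suc j * lam ^ suc j          ≈⟨ sym (-‿distribˡ-* _ _) ⟩
      - ((- 1#) ^ suc j * lam ^ suc j)        ≈⟨ -‿cong (sym (pow-* (- 1#) lam (suc j))) ⟩
      - (- 1# * lam) ^ suc j                  ≈⟨ -‿cong (pow-cong (suc j) (-1*x≈-x lam)) ⟩
      - (- lam) ^ suc j                       ∎

    W≈δ-Z : ∀ j i → W j i ≈ δ i - Z R i j lam
    W≈δ-Z zero i = sym (trans (+-congˡ ε⁻¹≈ε) (trans (+-identityʳ _) (sym (*-identityˡ _))))
    W≈δ-Z (suc j) i = begin
      W j i + a * exp ⌜ suc j ⌝ i     ≈⟨ +-cong (W≈δ-Z j i) (*-congˡ (sym (cast-^ (suc j) i))) ⟩
      (δ i - z) + a * q               ≈⟨ +-congˡ (*-congʳ (sym (-‿involutive a))) ⟩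
      (δ i - z) + - (- a) * q         ≈⟨ +-congˡ (sym (-‿distribˡ-* _ _)) ⟩
      (δ i - z) + - (- a * q)         ≈⟨ +-assoc _ _ _ ⟩
      δ i + (- z + - (- a * q))       ≈⟨ +-congˡ (sym (neg-+ _ _)) ⟩
      δ i - (z + - a * q)             ≈⟨ +-congˡ (-‿cong (+-congˡ (*-congʳ (sym (sign-of-Z-term j))))) ⟩
      δ i - Z R i (suc j) lam         ∎
      where
      a = (- lam) ^ suc j
      z = Z R i j lam
      q = ⌜ suc j N.^ i ⌝

    ⋆-W : ∀ j (f : Seq) n → (f ⋆ W j) n ≈ f n - (f ⋆ (λ i → Z R i j lam)) n
    ⋆-W j f n = begin
      (f ⋆ W j) n                                        ≈⟨ ⋆-congʳ f (W≈δ-Z j) n ⟩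
      (f ⋆ (λ i → δ i - Z R i j lam)) n                  ≈⟨ ⋆-+ʳ f δ (λ i → - Z R i j lam) n ⟩
      (f ⋆ δ) n + (f ⋆ (λ i → - Z R i j lam)) n          ≈⟨ +-cong (⋆-δ n f) (⋆-negʳ f (λ i → Z R i j lam) n) ⟩
      f n - (f ⋆ (λ i → Z R i j lam)) n                  ∎

corollary2p11 : ∀ {c ℓ : Level} (R : CommutativeRing c ℓ) → IsCharZeroField R →
    ∀ (m : ℕ) → OddN m → ∀ (n : ℕ) (lam : CommutativeRing.Carrier R)
    (G Gm : ℕ → CommutativeRing.Carrier R) →
    IsApostolGenocchi R lam G →
    IsApostolGenocchi R (pow R lam m) Gm →
    let open CommutativeRing R in
    pow R (cast R m) n * Gm n - cast R m * G n
    ≈ sumTo R n (λ k → cast R (n C k) * pow R (cast R m) k * Gm k * Z R (n ∸ k) (m ∸ 1) lam)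
corollary2p11 R F m (k , P.refl) n lam G Gm hG hGm =
  trans (swap-sub (⌜ m ⌝ * G n) (H n) _ mG≈H-HZ) (Σ-cong n (λ i → *-congʳ (sym (*-assoc _ _ _))))
  where
  open CommutativeRing R
  open Development R
  open Geometric lam
  H X : Seq
  H = dilate ⌜ m ⌝ Gm
  X = H ⋆ W (2 N.* k)
  L-X : ∀ n → L lam X n ≈ ⌜ m ⌝ * T n
  L-X n = trans (sym (L-⋆ lam H (W (2 N.* k)) n))
                (trans (⋆-congʳ H (L-W-odd k) n) (dilate-equation ⌜ m ⌝ (lam ^ m) Gm hGm n))
  -- X = m G by uniqueness, while X = H - H ⋆ Z by the coefficients of W
  mG≈H-HZ : ⌜ m ⌝ * G n ≈ H n - (H ⋆ (λ i → Z R i (2 N.* k) lam)) n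
  mG≈H-HZ = trans (sym (L-unique F lam ⌜ m ⌝ G X (apostol-genocchi-L lam G hG) L-X n))
                  (⋆-W (2 N.* k) H n)
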